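{- Let $k\ge1$, $n\ge1$, let $f:\mathfrak T^n\to\mathbb R$ be $k$-submodular with $f(\mathbf 0)=0$. For every $x\in P(f)$ the function $\overline x:\mathfrak T^n\to\mathbb R$ is $k$-supermodular, i.e. $\overline x(T\sqcap U)+\overline x(T\sqcup U)\ge\overline x(T)+\overline x(U)$ for all $T,U\in\mathfrak T^n$.
   Context: $\mathfrak T$ is a set consisting of a root $\mathbf o$ and a set $\mathfrak L$ of exactly $k$ leaves. Binary operations $\sqcap,\sqcup$ on $\mathfrak T$: $t\sqcap t=t\sqcup t=t$; for distinct leaves $a,b$: $a\sqcap b=a\sqcup b=\mathbf o$; for a leaf $a$: $a\sqcap\mathbf o=\mathbf o\sqcap a=\mathbf o$, $a\sqcup\mathbf o=\mathbf o\sqcup a=a$; they act componentwise on $\mathfrak T^n$; $\mathbf 0=(\mathbf o,\dots,\mathbf o)$. $f$ is $k$-submodular if $f(T\sqcap U)+f(T\sqcup U)\le f(T)+f(U)$ for all $T,U$. For $x=(x_{i\ell})_{i\in[n],\ell\in\mathfrak L}\in\mathbb R^{n\times\mathfrak L}$ define $\overline x(T)=\sum_{i=1}^n\overline x_i(T_i)$ with $\overline x_i(\mathbf o)=0$ and $\overline x_i(\ell)=x_{i\ell}$ for $\ell\in\mathfrak L$. $P(f)=\{x\in\mathbb R^{n\times\mathfrak L}:\overline x(T)\le f(T)\ \forall T\in\mathfrak T^n,\ \text{and } x_{i\ell}+x_{ip}\le0\ \forall i\in[n],\ \forall\text{ distinct }\ell,p\in\mathfrak L\}$. -}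

module Defs where

open import Level using (Level; suc) renaming (_⊔_ to _⊔ˡ_)
open import Data.Nat using (ℕ; zero) renaming (suc to sucℕ)
open import Data.Fin using (Fin) renaming (zero to fz; suc to fs)
open import Data.Fin.Properties using (_≟_)
open import Relation.Nullary using (yes; no)
open import Relation.Binary.Core using (Rel)
open import Relation.Binary.Structures using (IsTotalOrder)
open import Relation.Binary.PropositionalEquality using (_≢_)
open import Algebra.Structures using (IsCommutativeRing)
open import Data.Product using (_×_)

-- An ordered commutative ring (ℝ is an instance).  The paper's values are
-- real numbers; we state the result for every ordered commutative ring.
record OrderedCommutativeRing (c ℓ₁ ℓ₂ : Level) : Set (suc (c ⊔ˡ ℓ₁ ⊔ˡ ℓ₂)) where
  infix  4 _≈_ _≤_
  infixl 7 _*_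
  infixl 6 _+_
  field
    Carrier : Set c
    _≈_     : Rel Carrier ℓ₁
    _≤_     : Rel Carrier ℓ₂
    _+_     : Carrier → Carrier → Carrier
    _*_     : Carrier → Carrier → Carrier
    -_      : Carrier → Carrier
    0#      : Carrier
    1#      : Carrier
    isCommutativeRing : IsCommutativeRing _≈_ _+_ _*_ -_ 0# 1#
    isTotalOrder      : IsTotalOrder _≈_ _≤_
    +-monoˡ-≤         : ∀ {x y} z → x ≤ y → x + z ≤ y + z
    *-nonneg          : ∀ {x y} → 0# ≤ x → 0# ≤ y → 0# ≤ x * y

-- The star 𝔗 with root o and leaves indexed by Fin k.
data Node (k : ℕ) : Set where
  o    : Node k
  leaf : Fin k → Node k

_⊓ₒ_ : ∀ {k} → Node k → Node k → Node k
o      ⊓ₒ _      = o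
leaf a ⊓ₒ o      = o
leaf a ⊓ₒ leaf b with a ≟ b
... | yes _ = leaf a
... | no  _ = o

_⊔ₒ_ : ∀ {k} → Node k → Node k → Node k
o      ⊔ₒ t      = t
leaf a ⊔ₒ o      = leaf a
leaf a ⊔ₒ leaf b with a ≟ b
... | yes _ = leaf a
... | no  _ = o

Tn : ℕ → ℕ → Set
Tn k n = Fin n → Node k

_⊓_ : ∀ {k n} → Tn k n → Tn k n → Tn k n
(T ⊓ U) i = T i ⊓ₒ U i

_⊔_ : ∀ {k n} → Tn k n → Tn k n → Tn k n
(T ⊔ U) i = T i ⊔ₒ U i

𝟎 : ∀ {k n} → Tn k n
𝟎 _ = o

module _ {c ℓ₁ ℓ₂} (R : OrderedCommutativeRing c ℓ₁ ℓ₂) where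
  open OrderedCommutativeRing R

  sumFin : ∀ {n} → (Fin n → Carrier) → Carrier
  sumFin {zero}   g = 0#
  sumFin {sucℕ n} g = g fz + sumFin (λ i → g (fs i))

  IsKSubmodular : ∀ {k n} → (Tn k n → Carrier) → Set ℓ₂
  IsKSubmodular f = ∀ T U → f (T ⊓ U) + f (T ⊔ U) ≤ f T + f U

  IsKSupermodular : ∀ {k n} → (Tn k n → Carrier) → Set ℓ₂
  IsKSupermodular g = ∀ T U → g T + g U ≤ g (T ⊓ U) + g (T ⊔ U)

  xbarᵢ : ∀ {k} → (Fin k → Carrier) → Node k → Carrier
  xbarᵢ xi o        = 0#
  xbarᵢ xi (leaf ℓ) = xi ℓ

  xbar : ∀ {k n} → (Fin n → Fin k → Carrier) → Tn k n → Carrier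
  xbar x T = sumFin (λ i → xbarᵢ (x i) (T i))

  InP : ∀ {k n} → (Tn k n → Carrier) → (Fin n → Fin k → Carrier) → Set ℓ₂
  InP f x = (∀ T → xbar x T ≤ f T)
          × (∀ i ℓ p → ℓ ≢ p → x i ℓ + x i p ≤ 0#)

module Submission where

-- The function x̄ is *separable*: x̄(T) = Σᵢ x̄ᵢ(Tᵢ), and both
-- lattice operations ⊓, ⊔ act coordinatewise.  Hence the supermodular
-- inequality for x̄ is the coordinatewise sum of the one-coordinate
-- inequalities
--     x̄ᵢ(s) + x̄ᵢ(t) ≤ x̄ᵢ(s ⊓ₒ t) + x̄ᵢ(s ⊔ₒ t)     (s, t ∈ 𝔗).
-- The one-coordinate inequality is checked by cases on s, t: if one of them
-- is the root or s = t it is an equality (up to commutativity), and for two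
-- distinct leaves ℓ ≠ p it reads xᵢℓ + xᵢp ≤ 0 + 0, which is exactly the
-- second defining condition of P(f).  In particular only that condition of
-- P(f) is used.

open import Defs
open import Level using (Level)
open import Data.Nat using (ℕ; zero) renaming (suc to sucℕ)
open import Data.Fin using (Fin) renaming (zero to fz; suc to fs)
open import Data.Fin.Properties using (_≟_)
open import Relation.Nullary using (yes; no)
open import Relation.Binary.PropositionalEquality using (refl; _≢_)
open import Data.Product using (_,_)
open import Algebra.Bundles using (CommutativeRing)
import Algebra.Properties.CommutativeSemigroup as CommSemigroupProperties
open import Relation.Binary.Structures using (IsTotalOrder)

module OrderedRingLemmas {c ℓ₁ ℓ₂} (R : OrderedCommutativeRing c ℓ₁ ℓ₂) where
  open OrderedCommutativeRing R

  private
    ring : CommutativeRing c ℓ₁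
    ring = record { isCommutativeRing = isCommutativeRing }

  open CommutativeRing ring using (+-comm; +-identityˡ; +-commutativeSemigroup; sym)
  open CommSemigroupProperties +-commutativeSemigroup using (interchange)
  open IsTotalOrder isTotalOrder using (reflexive; trans) renaming (refl to ≤-refl)

  +-mono-≤ : ∀ {a b c d} → a ≤ b → c ≤ d → a + c ≤ b + d
  +-mono-≤ {a} {b} {c} {d} a≤b c≤d =
    trans (+-monoˡ-≤ c a≤b)
      (trans (reflexive (+-comm b c))
        (trans (+-monoˡ-≤ b c≤d) (reflexive (+-comm d b))))

  sumFin-mono₂ : ∀ {n} (g h p q : Fin n → Carrier)
               → (∀ i → g i + h i ≤ p i + q i)
               → sumFin R g + sumFin R h ≤ sumFin R p + sumFin R q
  sumFin-mono₂ {zero}   g h p q _  = ≤-refl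
  sumFin-mono₂ {sucℕ n} g h p q gh≤pq =
    trans (reflexive (interchange (g fz) _ (h fz) _))
      (trans (+-mono-≤ (gh≤pq fz) (sumFin-mono₂ (tail g) (tail h) (tail p) (tail q) (λ i → gh≤pq (fs i))))
        (reflexive (sym (interchange (p fz) _ (q fz) _))))
    where
      tail : (Fin (sucℕ n) → Carrier) → Fin n → Carrier
      tail v i = v (fs i)

  xbarᵢ-supermodular : ∀ {k} (xi : Fin k → Carrier)
                     → (∀ ℓ p → ℓ ≢ p → xi ℓ + xi p ≤ 0#)
                     → ∀ s t → xbarᵢ R xi s + xbarᵢ R xi t
                               ≤ xbarᵢ R xi (s ⊓ₒ t) + xbarᵢ R xi (s ⊔ₒ t)
  xbarᵢ-supermodular xi _        o        t        = ≤-refl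
  xbarᵢ-supermodular xi _        (leaf a) o        = reflexive (+-comm _ _)
  xbarᵢ-supermodular xi pair≤0 (leaf a) (leaf b) with a ≟ b
  ... | yes refl = ≤-refl
  ... | no  a≢b  = trans (pair≤0 a b a≢b) (reflexive (sym (+-identityˡ 0#)))

-- The ring's order _≤_ is used above; from here on _≤_ is the order on ℕ
-- occurring in the hypotheses 1 ≤ k, 1 ≤ n.
open import Data.Nat using (_≤_)

proposition3 : ∀ {c ℓ₁ ℓ₂ : Level} (R : OrderedCommutativeRing c ℓ₁ ℓ₂) (k n : ℕ)
    → 1 ≤ k → 1 ≤ n
    → (f : Tn k n → OrderedCommutativeRing.Carrier R)
    → IsKSubmodular R f
    → OrderedCommutativeRing._≈_ R (f 𝟎) (OrderedCommutativeRing.0# R)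
    → (x : Fin n → Fin k → OrderedCommutativeRing.Carrier R)
    → InP R f x
    → IsKSupermodular R (xbar R x)
proposition3 R k n _ _ f _ _ x (_ , pair≤0) T U =
  sumFin-mono₂ _ _ _ _ (λ i → xbarᵢ-supermodular (x i) (pair≤0 i) (T i) (U i))
  where open OrderedRingLemmas R
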